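{- Let $t\ge1$, $G=\mathbb{Z}_{4t+2}$, and let $\psi:G\times G\to\{\pm1\}$ be a normalized cocycle that is not a coboundary. Index the rows and columns of $M_\psi=[\psi(g,h)]$ by $1,\ldots,4t+2$, corresponding to the elements $0,1,\ldots,4t+1$. Then: (i) for $2\le i\le 4t+2$, the $i$th row sum of $M_\psi$ equals, up to sign, its $(4t+4-i)$th row sum; (ii) the $(2t+2)$th row sum of $M_\psi$ is $0$; (iii) $\psi$ is quasi-orthogonal if and only if the $i$th row sum of $M_\psi$ is $0$ for every even $i$ and $\pm2$ for every odd $i>1$.
   Context: A normalized cocycle satisfies $\psi(0,0)=1$ and $\psi(g,h)\psi(g+h,k)=\psi(g,h+k)\psi(h,k)$; a coboundary is one of the form $\partial\varphi(g,h)=\varphi(g)\varphi(h)\varphi(g+h)$ with $\varphi(0)=1$. Every non-coboundary over $\mathbb Z_{4t+2}$ has the form $\gamma\,\partial_{i_1}\cdots\partial_{i_w}$, where $\gamma(j,k)=(-1)^{\lfloor (j+k)/(4t+2)\rfloor}$ and $\partial_i=\partial\delta_i$, $\delta_i$ being $-1$ at the element $i-1$ and $1$ elsewhere. Row excess $RE(M_\psi)=\sum_{g\ne0}|\sum_h\psi(g,h)|$; a non-coboundary $\psi$ is quasi-orthogonal iff $RE(M_\psi)=4t$. -}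

module Defs where

open import Data.Nat as ℕ using (ℕ; zero; suc; _≤_; _<_)
open import Data.Nat.DivMod using (_%_; m%n<n)
open import Data.Integer as ℤ using (ℤ; +_; -_; ∣_∣)
open import Data.Fin as Fin using (Fin; toℕ; fromℕ<)
open import Data.Product using (Σ; _×_; _,_)
open import Data.Sum using (_⊎_)
open import Relation.Binary.PropositionalEquality using (_≡_)
open import Relation.Nullary using (¬_)

-- |G| = 4t+2, written as 2 + 4t so that it is syntactically a successor.
N : ℕ → ℕ
N t = 2 ℕ.+ 4 ℕ.* t

G : ℕ → Set
G t = Fin (N t)

toG : (t : ℕ) → ℕ → G t
toG t m = fromℕ< (m%n<n m (N t))

0G : (t : ℕ) → G t
0G t = Fin.zero

add : (t : ℕ) → G t → G t → G t
add t g h = toG t (toℕ g ℕ.+ toℕ h)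

IsSign : ℤ → Set
IsSign x = (x ≡ + 1) ⊎ (x ≡ - (+ 1))

IsNormalizedCocycle : (t : ℕ) → (G t → G t → ℤ) → Set
IsNormalizedCocycle t ψ =
  (∀ g h → IsSign (ψ g h)) ×
  (ψ (0G t) (0G t) ≡ + 1) ×
  (∀ g h k → ψ g h ℤ.* ψ (add t g h) k ≡ ψ g (add t h k) ℤ.* ψ h k)

∂ : (t : ℕ) → (G t → ℤ) → G t → G t → ℤ
∂ t φ g h = φ g ℤ.* φ h ℤ.* φ (add t g h)

IsCoboundary : (t : ℕ) → (G t → G t → ℤ) → Set
IsCoboundary t ψ =
  Σ (G t → ℤ) λ φ → (∀ g → IsSign (φ g)) × (φ (0G t) ≡ + 1) × (∀ g h → ψ g h ≡ ∂ t φ g h)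

Σℤ : {n : ℕ} → (Fin n → ℤ) → ℤ
Σℤ {zero} f = + 0
Σℤ {suc n} f = f Fin.zero ℤ.+ Σℤ (λ i → f (Fin.suc i))

Σℕ : {n : ℕ} → (Fin n → ℕ) → ℕ
Σℕ {zero} f = 0
Σℕ {suc n} f = f Fin.zero ℕ.+ Σℕ (λ i → f (Fin.suc i))

rowSumG : (t : ℕ) → (G t → G t → ℤ) → G t → ℤ
rowSumG t ψ g = Σℤ (λ h → ψ g h)

-- i-th row sum of M_ψ, rows indexed 1,...,4t+2 corresponding to 0,...,4t+1
-- (only meaningful for 1 ≤ i ≤ 4t+2)
rowSum : (t : ℕ) → (G t → G t → ℤ) → ℕ → ℤ
rowSum t ψ i = rowSumG t ψ (toG t (i ℕ.∸ 1))

RE : (t : ℕ) → (G t → G t → ℤ) → ℕ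
RE t ψ = Σℕ (λ (k : Fin (suc (4 ℕ.* t))) → ∣ rowSumG t ψ (Fin.suc k) ∣)

QuasiOrthogonal : (t : ℕ) → (G t → G t → ℤ) → Set
QuasiOrthogonal t ψ = RE t ψ ≡ 4 ℕ.* t

-- Pulled back to ℕ, ψ becomes a coboundary: ψ(a,b) = φ(a)φ(b)φ(a+b) with φ(k) = ψ(1,0)ψ(1,1)⋯ψ(1,k−1),
-- and φ(k+n) = twist·φ(k) for the sign twist = φ(n), n = 4t+2; twist = 1 would make ψ a coboundary on ℤ_n.
-- The row of a then sums to φ(a)·Σ_b φ(b)φ(a+b), and b ↦ φ(b)φ(a+b) is n-periodic, so shifting the
-- summation gives row(n−a) = ±row(a), with sign twist = −1 when a = n−a = 2t+1: this is (i) and (ii).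
-- For (iii), multiplying the cocycle identity over its third argument shows that a ↦ ∏_b ψ(a,b) is a
-- homomorphism to {±1} (n is even), hence 1 at even a; n ≡ 2 (mod 4) signs with product 1 sum to
-- 2 (mod 4), so |row(a)| ≥ 2 for the 2t nonzero even a. Thus RE ≥ 4t, with equality exactly when those
-- rows are ±2 and the odd rows vanish (the row of the element a has index a+1).

module Submission where

open import Defs
open import Data.Nat as ℕ using (ℕ; _≤_; _<_)
open import Data.Nat.Divisibility using (_∣_)
open import Data.Integer as ℤ using (ℤ; +_; -_)
open import Data.Product using (_×_)
open import Data.Sum using (_⊎_)
open import Function.Bundles using (_⇔_)
open import Relation.Binary.PropositionalEquality using (_≡_)
open import Relation.Nullary using (¬_)

open import Algebra.Bundles using (CommutativeMonoid)
import Algebra.Properties.CommutativeSemigroup as CommutativeSemigroupProperties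
open import Data.Nat.Base using (zero; suc; z≤n; s≤s; _∸_; ⌈_/2⌉)
import Data.Nat.Properties as ℕP
open import Data.Nat.DivMod using (_%_; _/_; m≡m%n+[m/n]*n; %-distribˡ-+; [m+n]%n≡m%n; m<n⇒m%n≡m)
open import Data.Nat.Divisibility using (divides-refl; _∣?_; _∣0; ∣-refl; ∣1⇒≡1; ∣m+n∣m⇒∣n; ∣m∣n⇒∣m+n)
import Data.Nat.Tactic.RingSolver as ℕSolver
open import Data.Integer using (_+_; _*_; _-_; _^_; ∣_∣; -[1+_])
import Data.Integer.Properties as ℤP
open import Data.Integer.Tactic.RingSolver using (solve-∀)
open import Data.Fin as Fin using (Fin; toℕ; fromℕ<)
import Data.Fin.Properties as FinP
open import Data.Product using (∃-syntax; _,_; proj₁; proj₂)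
open import Data.Sum using (inj₁; inj₂; [_,_]′)
open import Function using (_∘_)
open import Function.Bundles using (mk⇔)
open import Function.Construct.Composition using (_⇔-∘_)
open import Relation.Binary.PropositionalEquality
  using (refl; sym; trans; cong; cong₂; subst; subst₂; module ≡-Reasoning)
open import Relation.Nullary using (Dec; yes; no; contradiction)

IsSign-* : ∀ {x y} → IsSign x → IsSign y → IsSign (x * y)
IsSign-* (inj₁ refl) (inj₁ refl) = inj₁ refl
IsSign-* (inj₁ refl) (inj₂ refl) = inj₂ refl
IsSign-* (inj₂ refl) (inj₁ refl) = inj₂ refl
IsSign-* (inj₂ refl) (inj₂ refl) = inj₁ refl

IsSign⇒x*x≡1 : ∀ {x} → IsSign x → x * x ≡ + 1
IsSign⇒x*x≡1 (inj₁ refl) = refl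
IsSign⇒x*x≡1 (inj₂ refl) = refl

IsSign⇒*-involutive : ∀ {s} → IsSign s → ∀ x → s * (s * x) ≡ x
IsSign⇒*-involutive {s} s± x = begin
  s * (s * x) ≡⟨ ℤP.*-assoc s s x ⟨
  s * s * x   ≡⟨ cong (_* x) (IsSign⇒x*x≡1 s±) ⟩
  + 1 * x     ≡⟨ ℤP.*-identityˡ x ⟩
  x           ∎
  where open ≡-Reasoning

*-cancelʳ-IsSign : ∀ {s} x y → IsSign s → x * s ≡ y * s → x ≡ y
*-cancelʳ-IsSign x y (inj₁ refl) = ℤP.*-cancelʳ-≡ x y (+ 1)
*-cancelʳ-IsSign x y (inj₂ refl) = ℤP.*-cancelʳ-≡ x y (- + 1)

IsSign⇒^*2≡1 : ∀ {s} → IsSign s → ∀ q → s ^ (q ℕ.* 2) ≡ + 1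
IsSign⇒^*2≡1 s± zero = refl
IsSign⇒^*2≡1 {s} s± (suc q) = begin
  s * (s * s ^ (q ℕ.* 2)) ≡⟨ cong (λ z → s * (s * z)) (IsSign⇒^*2≡1 s± q) ⟩
  s * (s * + 1)           ≡⟨ IsSign⇒*-involutive s± (+ 1) ⟩
  + 1                     ∎
  where open ≡-Reasoning

≡IsSign*⇒≡± : ∀ {s x y} → IsSign s → y ≡ s * x → y ≡ x ⊎ y ≡ - x
≡IsSign*⇒≡± {x = x} (inj₁ refl) y≡x = inj₁ (trans y≡x (ℤP.*-identityˡ x))
≡IsSign*⇒≡± {x = x} (inj₂ refl) y≡-x = inj₂ (trans y≡-x (ℤP.-1*i≡-i x))

IsSign-+-mod-4 : ∀ {x y} → IsSign x → IsSign y → ∃[ e ] x + y ≡ + 1 + x * y + + 4 * e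
IsSign-+-mod-4 (inj₁ refl) (inj₁ refl) = + 0 , refl
IsSign-+-mod-4 (inj₁ refl) (inj₂ refl) = + 0 , refl
IsSign-+-mod-4 (inj₂ refl) (inj₁ refl) = + 0 , refl
IsSign-+-mod-4 (inj₂ refl) (inj₂ refl) = - + 1 , refl

x≡-x⇒x≡0 : ∀ {x} → x ≡ - x → x ≡ + 0
x≡-x⇒x≡0 {+ zero} _ = refl
x≡-x⇒x≡0 {+ suc _} ()
x≡-x⇒x≡0 { -[1+ _ ]} ()

∣x∣≡2⇒x≡±2 : ∀ x → ∣ x ∣ ≡ 2 → x ≡ + 2 ⊎ x ≡ - + 2
∣x∣≡2⇒x≡±2 (+ _) refl = inj₁ refl
∣x∣≡2⇒x≡±2 -[1+ _ ] refl = inj₂ refl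

2≤∣2+4q∣ : ∀ q → 2 ≤ ∣ + 2 + + 4 * q ∣
2≤∣2+4q∣ (+ m) = subst (λ z → 2 ≤ ∣ + 2 + z ∣) (ℤP.pos-* 4 m) (ℕP.m≤m+n 2 (4 ℕ.* m))
2≤∣2+4q∣ -[1+ m ] = subst (2 ≤_) (sym ∣2+4q∣) (2≤∣2+4q∣ (+ m))
  where
  2+4[-1-m]≡-[2+4m] : ∀ m → + 2 + + 4 * - (+ 1 + m) ≡ - (+ 2 + + 4 * m)
  2+4[-1-m]≡-[2+4m] = solve-∀
  ∣2+4q∣ : ∣ + 2 + + 4 * -[1+ m ] ∣ ≡ ∣ + 2 + + 4 * + m ∣
  ∣2+4q∣ = trans (cong ∣_∣ (2+4[-1-m]≡-[2+4m] (+ m))) (ℤP.∣-i∣≡∣i∣ (+ 2 + + 4 * + m))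

module RangeFold {c ℓ} (M : CommutativeMonoid c ℓ) where
  open CommutativeMonoid M
    using (Carrier; _≈_; _∙_; ε; setoid; commutativeSemigroup; ∙-cong; ∙-congˡ; assoc; comm; identityˡ; identityʳ)
    renaming (refl to ≈-refl; sym to ≈-sym; trans to ≈-trans)
  open CommutativeSemigroupProperties commutativeSemigroup using (interchange)
  open import Relation.Binary.Reasoning.Setoid setoid

  fold : ℕ → (ℕ → Carrier) → Carrier
  fold zero F = ε
  fold (suc k) F = F 0 ∙ fold k (λ j → F (suc j))

  fold-cong : ∀ k {F H} → (∀ j → F j ≈ H j) → fold k F ≈ fold k H
  fold-cong zero F≈H = ≈-refl
  fold-cong (suc k) F≈H = ∙-cong (F≈H 0) (fold-cong k (λ j → F≈H (suc j)))

  fold-snoc : ∀ k F → fold (suc k) F ≈ fold k F ∙ F k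
  fold-snoc zero F = ≈-trans (identityʳ (F 0)) (≈-sym (identityˡ (F 0)))
  fold-snoc (suc k) F = begin
    F 0 ∙ fold (suc k) (λ j → F (suc j))           ≈⟨ ∙-congˡ (fold-snoc k (λ j → F (suc j))) ⟩
    F 0 ∙ (fold k (λ j → F (suc j)) ∙ F (suc k))   ≈⟨ assoc _ _ _ ⟨
    F 0 ∙ fold k (λ j → F (suc j)) ∙ F (suc k)     ∎

  fold-∙ : ∀ k F H → fold k (λ j → F j ∙ H j) ≈ fold k F ∙ fold k H
  fold-∙ zero F H = ≈-sym (identityˡ ε)
  fold-∙ (suc k) F H = begin
    (F 0 ∙ H 0) ∙ fold k (λ j → F (suc j) ∙ H (suc j))
      ≈⟨ ∙-congˡ (fold-∙ k (λ j → F (suc j)) (λ j → H (suc j))) ⟩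
    (F 0 ∙ H 0) ∙ (fold k (λ j → F (suc j)) ∙ fold k (λ j → H (suc j)))
      ≈⟨ interchange _ _ _ _ ⟩
    (F 0 ∙ fold k (λ j → F (suc j))) ∙ (H 0 ∙ fold k (λ j → H (suc j))) ∎

  fold-rotate : ∀ n {F} → (∀ j → F (j ℕ.+ n) ≈ F j) → ∀ a → fold n (λ b → F (a ℕ.+ b)) ≈ fold n F
  fold-rotate n {F} F-periodic zero = ≈-refl
  fold-rotate n {F} F-periodic (suc a) = begin
    fold n (λ b → F (suc (a ℕ.+ b))) ≈⟨ fold-rotate n (λ j → F-periodic (suc j)) a ⟩
    fold n (λ b → F (suc b))         ≈⟨ rotate-once n F-periodic ⟩
    fold n F                         ∎
    where
    rotate-once : ∀ m {F} → (∀ j → F (j ℕ.+ m) ≈ F j) → fold m (λ j → F (suc j)) ≈ fold m F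
    rotate-once zero F-periodic = ≈-refl
    rotate-once (suc m) {F} F-periodic = begin
      fold (suc m) (λ j → F (suc j))       ≈⟨ fold-snoc m (λ j → F (suc j)) ⟩
      fold m (λ j → F (suc j)) ∙ F (suc m) ≈⟨ ∙-congˡ (F-periodic 0) ⟩
      fold m (λ j → F (suc j)) ∙ F 0       ≈⟨ comm _ _ ⟩
      F 0 ∙ fold m (λ j → F (suc j))       ∎

private
  module Sum = RangeFold ℤP.+-0-commutativeMonoid
  module Product = RangeFold ℤP.*-1-commutativeMonoid

∑ : ℕ → (ℕ → ℤ) → ℤ
∑ = Sum.fold
infix 5 ∑
syntax ∑ k (λ j → e) = ∑[ j < k ] e

∏ : ℕ → (ℕ → ℤ) → ℤ
∏ = Product.fold
infix 5 ∏
syntax ∏ k (λ j → e) = ∏[ j < k ] e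

∑-*ˡ : ∀ k c F → ∑[ j < k ] c * F j ≡ c * ∑ k F
∑-*ˡ zero c F = sym (ℤP.*-zeroʳ c)
∑-*ˡ (suc k) c F =
  trans (cong (_+_ (c * F 0)) (∑-*ˡ k c (λ j → F (suc j)))) (sym (ℤP.*-distribˡ-+ c (F 0) _))

∏-const : ∀ k x → ∏[ _ < k ] x ≡ x ^ k
∏-const zero x = refl
∏-const (suc k) x = cong (x *_) (∏-const k x)

∏-IsSign : ∀ k F → (∀ j → IsSign (F j)) → IsSign (∏ k F)
∏-IsSign zero F F± = inj₁ refl
∏-IsSign (suc k) F F± = IsSign-* (F± 0) (∏-IsSign k (λ j → F (suc j)) (λ j → F± (suc j)))

∑-IsSign-mod-4 : ∀ k F → (∀ j → IsSign (F j)) → ∃[ q ] ∑ k F ≡ + k - + 1 + ∏ k F + + 4 * q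
∑-IsSign-mod-4 zero F F± = + 0 , refl
∑-IsSign-mod-4 (suc k) F F± with ∑-IsSign-mod-4 k (λ j → F (suc j)) (λ j → F± (suc j))
                           | IsSign-+-mod-4 (F± 0) (∏-IsSign k (λ j → F (suc j)) (λ j → F± (suc j)))
... | q , ∑≡ | e , F₀+∏≡ = e + q , (begin
  F 0 + S                                           ≡⟨ cong (_+_ (F 0)) ∑≡ ⟩
  F 0 + (+ k - + 1 + P + + 4 * q)                   ≡⟨ regroup (F 0) (+ k) P q ⟩
  (F 0 + P) + (+ k - + 1 + + 4 * q)                 ≡⟨ cong (_+ (+ k - + 1 + + 4 * q)) F₀+∏≡ ⟩
  (+ 1 + F 0 * P + + 4 * e) + (+ k - + 1 + + 4 * q) ≡⟨ collect (F 0 * P) (+ k) e q ⟩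
  + 1 + + k - + 1 + F 0 * P + + 4 * (e + q)         ∎)
  where
  open ≡-Reasoning
  S P : ℤ
  S = ∑[ j < k ] F (suc j)
  P = ∏[ j < k ] F (suc j)
  regroup : ∀ x K p q → x + (K - + 1 + p + + 4 * q) ≡ (x + p) + (K - + 1 + + 4 * q)
  regroup = solve-∀
  collect : ∀ xp K e q →
    (+ 1 + xp + + 4 * e) + (K - + 1 + + 4 * q) ≡ + 1 + K - + 1 + xp + + 4 * (e + q)
  collect = solve-∀

Σℤ≡∑ : ∀ k {f : Fin k → ℤ} {F : ℕ → ℤ} → (∀ i → f i ≡ F (toℕ i)) → Σℤ f ≡ ∑ k F
Σℤ≡∑ zero f≡F = refl
Σℤ≡∑ (suc k) f≡F = cong₂ _+_ (f≡F Fin.zero) (Σℤ≡∑ k (λ i → f≡F (Fin.suc i)))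

Σℕ-cong : ∀ {k} {f g : Fin k → ℕ} → (∀ i → f i ≡ g i) → Σℕ f ≡ Σℕ g
Σℕ-cong {zero} f≡g = refl
Σℕ-cong {suc k} f≡g = cong₂ ℕ._+_ (f≡g Fin.zero) (Σℕ-cong (f≡g ∘ Fin.suc))

Σℕ-mono-≤ : ∀ {k} {f g : Fin k → ℕ} → (∀ i → f i ≤ g i) → Σℕ f ≤ Σℕ g
Σℕ-mono-≤ {zero} f≤g = z≤n
Σℕ-mono-≤ {suc k} f≤g = ℕP.+-mono-≤ (f≤g Fin.zero) (Σℕ-mono-≤ (f≤g ∘ Fin.suc))

+-tight : ∀ {a b c d} → a ≤ c → b ≤ d → a ℕ.+ b ≡ c ℕ.+ d → a ≡ c × b ≡ d
+-tight {a} {b} {c} {d} a≤c b≤d a+b≡c+d =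
  a≡c , ℕP.+-cancelˡ-≡ c b d (trans (cong (ℕ._+ b) (sym a≡c)) a+b≡c+d)
  where
  c≤a : c ≤ a
  c≤a = ℕP.+-cancelʳ-≤ b c a (ℕP.≤-trans (ℕP.+-monoʳ-≤ c b≤d) (ℕP.≤-reflexive (sym a+b≡c+d)))
  a≡c : a ≡ c
  a≡c = ℕP.≤-antisym a≤c c≤a

Σℕ-tight : ∀ {k} {f g : Fin k → ℕ} → (∀ i → f i ≤ g i) → Σℕ f ≡ Σℕ g → ∀ i → f i ≡ g i
Σℕ-tight {suc k} f≤g Σf≡Σg Fin.zero = proj₁ (+-tight (f≤g Fin.zero) (Σℕ-mono-≤ (f≤g ∘ Fin.suc)) Σf≡Σg)
Σℕ-tight {suc k} f≤g Σf≡Σg (Fin.suc i) =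
  Σℕ-tight (f≤g ∘ Fin.suc) (proj₂ (+-tight (f≤g Fin.zero) (Σℕ-mono-≤ (f≤g ∘ Fin.suc)) Σf≡Σg)) i

module _ (t : ℕ) where

  toℕ-toG : ∀ a → toℕ (toG t a) ≡ a % N t
  toℕ-toG a = FinP.toℕ-fromℕ< _

  toG-toℕ : ∀ g → toG t (toℕ g) ≡ g
  toG-toℕ g = FinP.toℕ-injective (trans (toℕ-toG (toℕ g)) (m<n⇒m%n≡m (FinP.toℕ<n g)))

  toG-+ : ∀ a b → toG t (a ℕ.+ b) ≡ add t (toG t a) (toG t b)
  toG-+ a b = FinP.toℕ-injective (begin
    toℕ (toG t (a ℕ.+ b))                   ≡⟨ toℕ-toG (a ℕ.+ b) ⟩
    (a ℕ.+ b) % N t                         ≡⟨ %-distribˡ-+ a b (N t) ⟩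
    (a % N t ℕ.+ b % N t) % N t             ≡⟨ cong₂ (λ x y → (x ℕ.+ y) % N t) (toℕ-toG a) (toℕ-toG b) ⟨
    (toℕ (toG t a) ℕ.+ toℕ (toG t b)) % N t ≡⟨ toℕ-toG (toℕ (toG t a) ℕ.+ toℕ (toG t b)) ⟨
    toℕ (add t (toG t a) (toG t b))         ∎)
    where open ≡-Reasoning

  toG-periodic : ∀ a → toG t (a ℕ.+ N t) ≡ toG t a
  toG-periodic a = FinP.toℕ-injective
    (trans (toℕ-toG (a ℕ.+ N t)) (trans ([m+n]%n≡m%n a (N t)) (sym (toℕ-toG a))))

rowBound : ℕ → ℕ
rowBound zero = 2
rowBound (suc zero) = 0
rowBound (suc (suc a)) = rowBound a

2∣suc⇒rowBound≡0 : ∀ a → 2 ∣ suc a → rowBound a ≡ 0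
2∣suc⇒rowBound≡0 zero 2∣1 = contradiction (∣1⇒≡1 2∣1) λ ()
2∣suc⇒rowBound≡0 (suc zero) _ = refl
2∣suc⇒rowBound≡0 (suc (suc a)) 2∣3+a = 2∣suc⇒rowBound≡0 a (∣m+n∣m⇒∣n 2∣3+a ∣-refl)

2∤suc⇒rowBound≡2 : ∀ a → ¬ 2 ∣ suc a → rowBound a ≡ 2
2∤suc⇒rowBound≡2 zero _ = refl
2∤suc⇒rowBound≡2 (suc zero) 2∤2 = contradiction ∣-refl 2∤2
2∤suc⇒rowBound≡2 (suc (suc a)) 2∤3+a = 2∤suc⇒rowBound≡2 a (2∤3+a ∘ ∣m∣n⇒∣m+n ∣-refl)

2∤suc⇒2∣ : ∀ a → ¬ 2 ∣ suc a → 2 ∣ a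
2∤suc⇒2∣ zero _ = 2 ∣0
2∤suc⇒2∣ (suc zero) 2∤2 = contradiction ∣-refl 2∤2
2∤suc⇒2∣ (suc (suc a)) 2∤3+a = ∣m∣n⇒∣m+n ∣-refl (2∤suc⇒2∣ a (2∤3+a ∘ ∣m∣n⇒∣m+n ∣-refl))

Σℕ-rowBound : ∀ k → Σℕ {k} (λ i → rowBound (toℕ i)) ≡ 2 ℕ.* ⌈ k /2⌉
Σℕ-rowBound zero = refl
Σℕ-rowBound (suc zero) = refl
Σℕ-rowBound (suc (suc k)) = trans (cong (2 ℕ.+_) (Σℕ-rowBound k)) (sym (ℕP.*-suc 2 ⌈ k /2⌉))

⌈n+n/2⌉≡n : ∀ m → ⌈ m ℕ.+ m /2⌉ ≡ m
⌈n+n/2⌉≡n m = ℕP.+-cancelˡ-≡ m ⌈ m ℕ.+ m /2⌉ m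
  (trans (cong (ℕ._+ ⌈ m ℕ.+ m /2⌉) (ℕP.n≡⌊n+n/2⌋ m)) (ℕP.⌊n/2⌋+⌈n/2⌉≡n (m ℕ.+ m)))

Σℕ-rowBound-nonzero : ∀ t → Σℕ {suc (4 ℕ.* t)} (λ i → rowBound (suc (toℕ i))) ≡ 4 ℕ.* t
-- The chain starts definitionally: the first term rowBound 1 is 0, and rowBound (2 + i) = rowBound i.
Σℕ-rowBound-nonzero t = begin
  Σℕ {4 ℕ.* t} (λ i → rowBound (toℕ i)) ≡⟨ Σℕ-rowBound (4 ℕ.* t) ⟩
  2 ℕ.* ⌈ 4 ℕ.* t /2⌉                  ≡⟨ cong (λ x → 2 ℕ.* ⌈ x /2⌉) (4t≡2t+2t t) ⟩
  2 ℕ.* ⌈ 2 ℕ.* t ℕ.+ 2 ℕ.* t /2⌉      ≡⟨ cong (2 ℕ.*_) (⌈n+n/2⌉≡n (2 ℕ.* t)) ⟩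
  2 ℕ.* (2 ℕ.* t)                      ≡⟨ ℕP.*-assoc 2 2 t ⟨
  4 ℕ.* t                              ∎
  where
  open ≡-Reasoning
  4t≡2t+2t : ∀ t → 4 ℕ.* t ≡ 2 ℕ.* t ℕ.+ 2 ℕ.* t
  4t≡2t+2t = ℕSolver.solve-∀

2+j≤u+2⇒j<1+u : ∀ {u j} → suc (suc j) ≤ u ℕ.+ 2 → j < suc u
2+j≤u+2⇒j<1+u {u} {j} 2+j≤u+2 =
  s≤s (ℕP.+-cancelˡ-≤ 2 _ _ (subst (suc (suc j) ≤_) (ℕP.+-comm u 2) 2+j≤u+2))

j<1+u⇒2+j≤u+2 : ∀ {u j} → j < suc u → suc (suc j) ≤ u ℕ.+ 2
j<1+u⇒2+j≤u+2 {u} {j} j<1+u = subst (suc (suc j) ≤_) (ℕP.+-comm 2 u) (s≤s j<1+u)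

mirror-index : ∀ u a → a ≤ u ℕ.+ 2 → a ℕ.+ ((u ℕ.+ 4 ∸ suc a) ∸ 1) ≡ 2 ℕ.+ u
mirror-index u a a≤u+2 = begin
  a ℕ.+ ((u ℕ.+ 4 ∸ suc a) ∸ 1)         ≡⟨ cong (λ x → a ℕ.+ ((x ∸ suc a) ∸ 1)) (u+4≡2+[u+2] u) ⟩
  a ℕ.+ ((1 ℕ.+ (u ℕ.+ 2) ∸ a) ∸ 1)     ≡⟨ cong (λ x → a ℕ.+ (x ∸ 1)) (ℕP.+-∸-assoc 1 a≤u+2) ⟩
  a ℕ.+ (u ℕ.+ 2 ∸ a)                   ≡⟨ ℕP.m+[n∸m]≡n a≤u+2 ⟩
  u ℕ.+ 2                               ≡⟨ ℕP.+-comm u 2 ⟩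
  2 ℕ.+ u                               ∎
  where
  open ≡-Reasoning
  u+4≡2+[u+2] : ∀ u → u ℕ.+ 4 ≡ 2 ℕ.+ (u ℕ.+ 2)
  u+4≡2+[u+2] = ℕSolver.solve-∀

module Rows (t : ℕ) (ψ : G t → G t → ℤ)
            (ψ-sign : ∀ g h → IsSign (ψ g h))
            (ψ-normalized : ψ (0G t) (0G t) ≡ + 1)
            (ψ-cocycle : ∀ g h k → ψ g h * ψ (add t g h) k ≡ ψ g (add t h k) * ψ h k) where

  open ≡-Reasoning
  open CommutativeSemigroupProperties ℤP.*-commutativeSemigroup using (x∙yz≈y∙xz; interchange)

  n : ℕ
  n = N t

  ψℕ : ℕ → ℕ → ℤ
  ψℕ a b = ψ (toG t a) (toG t b)

  ψℕ-sign : ∀ a b → IsSign (ψℕ a b)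
  ψℕ-sign a b = ψ-sign (toG t a) (toG t b)

  ψℕ-cocycle : ∀ a b c → ψℕ a b * ψℕ (a ℕ.+ b) c ≡ ψℕ a (b ℕ.+ c) * ψℕ b c
  ψℕ-cocycle a b c = begin
    ψℕ a b * ψ (toG t (a ℕ.+ b)) (toG t c)
      ≡⟨ cong (λ g → ψℕ a b * ψ g (toG t c)) (toG-+ t a b) ⟩
    ψℕ a b * ψ (add t (toG t a) (toG t b)) (toG t c)
      ≡⟨ ψ-cocycle (toG t a) (toG t b) (toG t c) ⟩
    ψ (toG t a) (add t (toG t b) (toG t c)) * ψℕ b c
      ≡⟨ cong (λ g → ψ (toG t a) g * ψℕ b c) (toG-+ t b c) ⟨
    ψℕ a (b ℕ.+ c) * ψℕ b c ∎

  ψℕ-periodicʳ : ∀ a b → ψℕ a (b ℕ.+ n) ≡ ψℕ a b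
  ψℕ-periodicʳ a b = cong (ψ (toG t a)) (toG-periodic t b)

  ψℕ-0ˡ : ∀ b → ψℕ 0 b ≡ + 1
  ψℕ-0ˡ b = sym (*-cancelʳ-IsSign (+ 1) (ψℕ 0 b) (ψℕ-sign 0 b)
    (trans (cong (_* ψℕ 0 b) (sym ψ-normalized)) (ψℕ-cocycle 0 0 b)))

  φ : ℕ → ℤ
  φ zero = + 1
  φ (suc k) = ψℕ 1 k * φ k

  φ-sign : ∀ k → IsSign (φ k)
  φ-sign zero = inj₁ refl
  φ-sign (suc k) = IsSign-* (ψℕ-sign 1 k) (φ-sign k)

  ψℕ≡∂φ : ∀ a b → ψℕ a b ≡ φ a * φ b * φ (a ℕ.+ b)
  ψℕ≡∂φ zero b = begin
    ψℕ 0 b          ≡⟨ ψℕ-0ˡ b ⟩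
    + 1             ≡⟨ IsSign⇒x*x≡1 (φ-sign b) ⟨
    φ b * φ b       ≡⟨ cong (_* φ b) (ℤP.*-identityˡ (φ b)) ⟨
    + 1 * φ b * φ b ∎
  ψℕ≡∂φ (suc a) b = begin
    ψℕ (suc a) b
      ≡⟨ IsSign⇒*-involutive (ψℕ-sign 1 a) (ψℕ (suc a) b) ⟨
    ψℕ 1 a * (ψℕ 1 a * ψℕ (suc a) b)
      ≡⟨ cong (ψℕ 1 a *_) (ψℕ-cocycle 1 a b) ⟩
    ψℕ 1 a * (ψℕ 1 (a ℕ.+ b) * ψℕ a b)
      ≡⟨ cong (λ z → ψℕ 1 a * (ψℕ 1 (a ℕ.+ b) * z)) (ψℕ≡∂φ a b) ⟩
    ψℕ 1 a * (ψℕ 1 (a ℕ.+ b) * (φ a * φ b * φ (a ℕ.+ b)))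
      ≡⟨ regroup (ψℕ 1 a) (ψℕ 1 (a ℕ.+ b)) (φ a) (φ b) (φ (a ℕ.+ b)) ⟩
    (ψℕ 1 a * φ a) * φ b * (ψℕ 1 (a ℕ.+ b) * φ (a ℕ.+ b)) ∎
    where
    regroup : ∀ p q x y z → p * (q * (x * y * z)) ≡ (p * x) * y * (q * z)
    regroup = solve-∀

  twist : ℤ
  twist = φ n

  twist-sign : IsSign twist
  twist-sign = φ-sign n

  φ-twisted : ∀ k → φ (k ℕ.+ n) ≡ twist * φ k
  φ-twisted zero = sym (ℤP.*-identityʳ twist)
  φ-twisted (suc k) = begin
    ψℕ 1 (k ℕ.+ n) * φ (k ℕ.+ n) ≡⟨ cong₂ _*_ (ψℕ-periodicʳ 1 k) (φ-twisted k) ⟩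
    ψℕ 1 k * (twist * φ k)       ≡⟨ x∙yz≈y∙xz (ψℕ 1 k) twist (φ k) ⟩
    twist * (ψℕ 1 k * φ k)       ∎

  φ-periodic : twist ≡ + 1 → ∀ k → φ (k ℕ.+ n) ≡ φ k
  φ-periodic twist≡1 k = trans (φ-twisted k) (trans (cong (_* φ k) twist≡1) (ℤP.*-identityˡ (φ k)))

  φ-mod : twist ≡ + 1 → ∀ a → φ (a % n) ≡ φ a
  φ-mod twist≡1 a = trans (sym (φ-+* (a / n) (a % n))) (cong φ (sym (m≡m%n+[m/n]*n a n)))
    where
    φ-+* : ∀ q r → φ (r ℕ.+ q ℕ.* n) ≡ φ r
    φ-+* zero r = cong φ (ℕP.+-identityʳ r)
    φ-+* (suc q) r = begin
      φ (r ℕ.+ (n ℕ.+ q ℕ.* n)) ≡⟨ cong (λ k → φ (r ℕ.+ k)) (ℕP.+-comm n (q ℕ.* n)) ⟩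
      φ (r ℕ.+ (q ℕ.* n ℕ.+ n)) ≡⟨ cong φ (ℕP.+-assoc r (q ℕ.* n) n) ⟨
      φ (r ℕ.+ q ℕ.* n ℕ.+ n)   ≡⟨ φ-periodic twist≡1 (r ℕ.+ q ℕ.* n) ⟩
      φ (r ℕ.+ q ℕ.* n)         ≡⟨ φ-+* q r ⟩
      φ r                       ∎

  twist≡1⇒coboundary : twist ≡ + 1 → IsCoboundary t ψ
  twist≡1⇒coboundary twist≡1 = φ ∘ toℕ , φ-sign ∘ toℕ , refl , ψ≡∂φ
    where
    ψ≡∂φ : ∀ g h → ψ g h ≡ ∂ t (φ ∘ toℕ) g h
    ψ≡∂φ g h = begin
      ψ g h                                         ≡⟨ cong₂ ψ (toG-toℕ t g) (toG-toℕ t h) ⟨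
      ψℕ (toℕ g) (toℕ h)                            ≡⟨ ψℕ≡∂φ (toℕ g) (toℕ h) ⟩
      φ (toℕ g) * φ (toℕ h) * φ (toℕ g ℕ.+ toℕ h)   ≡⟨ cong (φ (toℕ g) * φ (toℕ h) *_) φ[g+h] ⟨
      φ (toℕ g) * φ (toℕ h) * φ (toℕ (add t g h))   ∎
      where
      φ[g+h] : φ (toℕ (add t g h)) ≡ φ (toℕ g ℕ.+ toℕ h)
      φ[g+h] = trans (cong φ (toℕ-toG t (toℕ g ℕ.+ toℕ h))) (φ-mod twist≡1 (toℕ g ℕ.+ toℕ h))

  ¬coboundary⇒twist≡-1 : ¬ IsCoboundary t ψ → twist ≡ - + 1
  ¬coboundary⇒twist≡-1 ¬coboundary with twist-sign
  ... | inj₁ twist≡1 = contradiction (twist≡1⇒coboundary twist≡1) ¬coboundary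
  ... | inj₂ twist≡-1 = twist≡-1

  row : ℕ → ℤ
  row a = ∑[ b < n ] ψℕ a b

  rowSumG-toG : ∀ a → rowSumG t ψ (toG t a) ≡ row a
  rowSumG-toG a = Σℤ≡∑ n {F = ψℕ a} (λ h → cong (ψ (toG t a)) (sym (toG-toℕ t h)))

  rowSumG≡row : ∀ g → rowSumG t ψ g ≡ row (toℕ g)
  rowSumG≡row g = trans (cong (rowSumG t ψ) (sym (toG-toℕ t g))) (rowSumG-toG (toℕ g))

  row-reflect : ∀ m a → m ℕ.+ a ≡ n → row m ≡ φ m * (twist * φ a) * row a
  row-reflect m a m+a≡n = begin
    row m                                   ≡⟨ Sum.fold-cong n (λ b → trans (ψℕ≡∂φ m b) (ℤP.*-assoc (φ m) _ _)) ⟩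
    ∑[ b < n ] φ m * H b                    ≡⟨ ∑-*ˡ n (φ m) H ⟩
    φ m * ∑ n H                             ≡⟨ cong (φ m *_) (Sum.fold-rotate n H-periodic a) ⟨
    φ m * (∑[ b < n ] H (a ℕ.+ b))          ≡⟨ cong (φ m *_) (Sum.fold-cong n H-shift) ⟩
    φ m * (∑[ b < n ] twist * φ a * ψℕ a b) ≡⟨ cong (φ m *_) (∑-*ˡ n (twist * φ a) (ψℕ a)) ⟩
    φ m * (twist * φ a * row a)             ≡⟨ ℤP.*-assoc (φ m) (twist * φ a) (row a) ⟨
    φ m * (twist * φ a) * row a             ∎
    where
    H : ℕ → ℤ
    H b = φ b * φ (m ℕ.+ b)

    H-periodic : ∀ b → H (b ℕ.+ n) ≡ H b
    H-periodic b = begin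
      φ (b ℕ.+ n) * φ (m ℕ.+ (b ℕ.+ n))   ≡⟨ cong (λ k → φ (b ℕ.+ n) * φ k) (ℕP.+-assoc m b n) ⟨
      φ (b ℕ.+ n) * φ (m ℕ.+ b ℕ.+ n)     ≡⟨ cong₂ _*_ (φ-twisted b) (φ-twisted (m ℕ.+ b)) ⟩
      twist * φ b * (twist * φ (m ℕ.+ b)) ≡⟨ interchange twist (φ b) twist (φ (m ℕ.+ b)) ⟩
      twist * twist * H b                 ≡⟨ cong (_* H b) (IsSign⇒x*x≡1 twist-sign) ⟩
      + 1 * H b                           ≡⟨ ℤP.*-identityˡ (H b) ⟩
      H b                                 ∎

    H-shift : ∀ b → H (a ℕ.+ b) ≡ twist * φ a * ψℕ a b
    H-shift b = begin
      φ (a ℕ.+ b) * φ (m ℕ.+ (a ℕ.+ b))         ≡⟨ cong (λ k → φ (a ℕ.+ b) * φ k) m+[a+b]≡b+n ⟩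
      φ (a ℕ.+ b) * φ (b ℕ.+ n)                 ≡⟨ cong (φ (a ℕ.+ b) *_) (φ-twisted b) ⟩
      φ (a ℕ.+ b) * (twist * φ b)               ≡⟨ ℤP.*-identityˡ _ ⟨
      + 1 * (φ (a ℕ.+ b) * (twist * φ b))
        ≡⟨ cong (_* (φ (a ℕ.+ b) * (twist * φ b))) (IsSign⇒x*x≡1 (φ-sign a)) ⟨
      φ a * φ a * (φ (a ℕ.+ b) * (twist * φ b)) ≡⟨ regroup twist (φ a) (φ b) (φ (a ℕ.+ b)) ⟩
      twist * φ a * (φ a * φ b * φ (a ℕ.+ b))   ≡⟨ cong (twist * φ a *_) (ψℕ≡∂φ a b) ⟨
      twist * φ a * ψℕ a b                      ∎
      where
      m+[a+b]≡b+n : m ℕ.+ (a ℕ.+ b) ≡ b ℕ.+ n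
      m+[a+b]≡b+n = trans (sym (ℕP.+-assoc m a b)) (trans (cong (ℕ._+ b) m+a≡n) (ℕP.+-comm n b))
      regroup : ∀ d x y z → x * x * (z * (d * y)) ≡ d * x * (x * y * z)
      regroup = solve-∀

  row-mirror : ∀ m a → m ℕ.+ a ≡ n → row m ≡ row a ⊎ row m ≡ - row a
  row-mirror m a m+a≡n =
    ≡IsSign*⇒≡± (IsSign-* (φ-sign m) (IsSign-* twist-sign (φ-sign a))) (row-reflect m a m+a≡n)

  row-self-mirror : ∀ a → a ℕ.+ a ≡ n → row a ≡ twist * row a
  row-self-mirror a a+a≡n = trans (row-reflect a a a+a≡n) (cong (_* row a) φa*[twist*φa]≡twist)
    where
    φa*[twist*φa]≡twist : φ a * (twist * φ a) ≡ twist
    φa*[twist*φa]≡twist = begin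
      φ a * (twist * φ a) ≡⟨ x∙yz≈y∙xz (φ a) twist (φ a) ⟩
      twist * (φ a * φ a) ≡⟨ cong (twist *_) (IsSign⇒x*x≡1 (φ-sign a)) ⟩
      twist * + 1         ≡⟨ ℤP.*-identityʳ twist ⟩
      twist               ∎

  rowProduct : ℕ → ℤ
  rowProduct a = ∏[ c < n ] ψℕ a c

  rowProduct-+ : ∀ a b → rowProduct (a ℕ.+ b) ≡ rowProduct a * rowProduct b
  rowProduct-+ a b = begin
    rowProduct (a ℕ.+ b)                       ≡⟨ ℤP.*-identityˡ _ ⟨
    + 1 * rowProduct (a ℕ.+ b)                 ≡⟨ cong (_* rowProduct (a ℕ.+ b)) ∏ψℕab≡1 ⟨
    (∏[ c < n ] ψℕ a b) * rowProduct (a ℕ.+ b) ≡⟨ Product.fold-∙ n (λ _ → ψℕ a b) (ψℕ (a ℕ.+ b)) ⟨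
    ∏[ c < n ] ψℕ a b * ψℕ (a ℕ.+ b) c         ≡⟨ Product.fold-cong n (ψℕ-cocycle a b) ⟩
    ∏[ c < n ] ψℕ a (b ℕ.+ c) * ψℕ b c         ≡⟨ Product.fold-∙ n (λ c → ψℕ a (b ℕ.+ c)) (ψℕ b) ⟩
    (∏[ c < n ] ψℕ a (b ℕ.+ c)) * rowProduct b ≡⟨ cong (_* rowProduct b) (Product.fold-rotate n (ψℕ-periodicʳ a) b) ⟩
    rowProduct a * rowProduct b                ∎
    where
    N≡[1+2t]*2 : ∀ t → 2 ℕ.+ 4 ℕ.* t ≡ suc (2 ℕ.* t) ℕ.* 2
    N≡[1+2t]*2 = ℕSolver.solve-∀
    ∏ψℕab≡1 : ∏[ c < n ] ψℕ a b ≡ + 1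
    ∏ψℕab≡1 = trans (∏-const n (ψℕ a b))
      (subst (λ k → ψℕ a b ^ k ≡ + 1) (sym (N≡[1+2t]*2 t))
        (IsSign⇒^*2≡1 (ψℕ-sign a b) (suc (2 ℕ.* t))))

  rowProduct-double : ∀ m → rowProduct (m ℕ.+ m) ≡ + 1
  rowProduct-double m = trans (rowProduct-+ m m) (IsSign⇒x*x≡1 (∏-IsSign n (ψℕ m) (ψℕ-sign m)))

  2≤∣row∣ : ∀ {a} → 2 ∣ a → 2 ≤ ∣ row a ∣
  2≤∣row∣ (divides-refl m) = row-bound (proj₂ (∑-IsSign-mod-4 n (ψℕ (m ℕ.* 2)) (ψℕ-sign (m ℕ.* 2))))
    where
    mod-4-value : ∀ q → + n - + 1 + rowProduct (m ℕ.* 2) + + 4 * q ≡ + 2 + + 4 * (+ t + q)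
    mod-4-value q = begin
      + n - + 1 + rowProduct (m ℕ.* 2) + + 4 * q
        ≡⟨ cong₂ (λ x y → x - + 1 + y + + 4 * q) +n≡2+4t
                 (trans (cong rowProduct (m*2≡m+m m)) (rowProduct-double m)) ⟩
      + 2 + + 4 * + t - + 1 + + 1 + + 4 * q
        ≡⟨ collect (+ t) q ⟩
      + 2 + + 4 * (+ t + q) ∎
      where
      m*2≡m+m : ∀ m → m ℕ.* 2 ≡ m ℕ.+ m
      m*2≡m+m = ℕSolver.solve-∀
      +n≡2+4t : + n ≡ + 2 + + 4 * + t
      +n≡2+4t = trans (ℤP.pos-+ 2 (4 ℕ.* t)) (cong (_+_ (+ 2)) (ℤP.pos-* 4 t))
      collect : ∀ T q → + 2 + + 4 * T - + 1 + + 1 + + 4 * q ≡ + 2 + + 4 * (T + q)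
      collect = solve-∀
    row-bound : ∀ {x q} → x ≡ + n - + 1 + rowProduct (m ℕ.* 2) + + 4 * q → 2 ≤ ∣ x ∣
    row-bound {x} {q} x≡ = subst (λ z → 2 ≤ ∣ z ∣) (sym (trans x≡ (mod-4-value q))) (2≤∣2+4q∣ (+ t + q))

  rowBound≤∣row∣ : ∀ a → rowBound a ≤ ∣ row a ∣
  rowBound≤∣row∣ a with 2 ∣? suc a
  ... | yes 2∣1+a = subst (_≤ ∣ row a ∣) (sym (2∣suc⇒rowBound≡0 a 2∣1+a)) z≤n
  ... | no 2∤1+a =
    subst (_≤ ∣ row a ∣) (sym (2∤suc⇒rowBound≡2 a 2∤1+a)) (2≤∣row∣ (2∤suc⇒2∣ a 2∤1+a))

  RE≡Σ∣row∣ : RE t ψ ≡ Σℕ (λ (k : Fin (suc (4 ℕ.* t))) → ∣ row (suc (toℕ k)) ∣)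
  RE≡Σ∣row∣ = Σℕ-cong (λ k → cong ∣_∣ (rowSumG≡row (Fin.suc k)))

  RowBoundsAttained : Set
  RowBoundsAttained = ∀ (k : Fin (suc (4 ℕ.* t))) → rowBound (suc (toℕ k)) ≡ ∣ row (suc (toℕ k)) ∣

  quasiOrthogonal⇔rowBoundsAttained : QuasiOrthogonal t ψ ⇔ RowBoundsAttained
  quasiOrthogonal⇔rowBoundsAttained = mk⇔
    (λ RE≡4t → Σℕ-tight (λ k → rowBound≤∣row∣ (suc (toℕ k)))
                         (trans (Σℕ-rowBound-nonzero t) (trans (sym RE≡4t) RE≡Σ∣row∣)))
    (λ attained → trans RE≡Σ∣row∣ (trans (Σℕ-cong (sym ∘ attained)) (Σℕ-rowBound-nonzero t)))

  rowSum≡row : ∀ i → rowSum t ψ i ≡ row (i ∸ 1)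
  rowSum≡row i = rowSumG-toG (i ∸ 1)

  rowSum-mirror : (i : ℕ) → 2 ≤ i → i ≤ 4 ℕ.* t ℕ.+ 2 →
    (rowSum t ψ i ≡ rowSum t ψ (4 ℕ.* t ℕ.+ 4 ℕ.∸ i))
    ⊎ (rowSum t ψ i ≡ - rowSum t ψ (4 ℕ.* t ℕ.+ 4 ℕ.∸ i))
  rowSum-mirror (suc a) _ 1+a≤4t+2 =
    subst₂ (λ x y → x ≡ y ⊎ x ≡ - y) (sym (rowSum≡row (suc a))) (sym (rowSum≡row i′))
      (row-mirror a (i′ ∸ 1) (mirror-index (4 ℕ.* t) a (ℕP.≤-trans (ℕP.n≤1+n a) 1+a≤4t+2)))
    where
    i′ : ℕ
    i′ = 4 ℕ.* t ℕ.+ 4 ∸ suc a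

  rowSum-middle≡0 : ¬ IsCoboundary t ψ → rowSum t ψ (2 ℕ.* t ℕ.+ 2) ≡ + 0
  rowSum-middle≡0 ¬coboundary = begin
    rowSum t ψ (2 ℕ.* t ℕ.+ 2) ≡⟨ rowSum≡row (2 ℕ.* t ℕ.+ 2) ⟩
    row (2 ℕ.* t ℕ.+ 2 ∸ 1)    ≡⟨ cong (λ x → row (x ∸ 1)) (ℕP.+-comm (2 ℕ.* t) 2) ⟩
    row (suc (2 ℕ.* t))        ≡⟨ x≡-x⇒x≡0 row≡-row ⟩
    + 0                        ∎
    where
    1+2t+1+2t≡N : ∀ t → suc (2 ℕ.* t) ℕ.+ suc (2 ℕ.* t) ≡ 2 ℕ.+ 4 ℕ.* t
    1+2t+1+2t≡N = ℕSolver.solve-∀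
    row≡-row : row (suc (2 ℕ.* t)) ≡ - row (suc (2 ℕ.* t))
    row≡-row = begin
      row (suc (2 ℕ.* t))          ≡⟨ row-self-mirror (suc (2 ℕ.* t)) (1+2t+1+2t≡N t) ⟩
      twist * row (suc (2 ℕ.* t))  ≡⟨ cong (_* row (suc (2 ℕ.* t))) (¬coboundary⇒twist≡-1 ¬coboundary) ⟩
      - + 1 * row (suc (2 ℕ.* t))  ≡⟨ ℤP.-1*i≡-i (row (suc (2 ℕ.* t))) ⟩
      - row (suc (2 ℕ.* t))        ∎

  EvenRowSumsVanish : Set
  EvenRowSumsVanish = (i : ℕ) → 1 ≤ i → i ≤ 4 ℕ.* t ℕ.+ 2 → 2 ∣ i → rowSum t ψ i ≡ + 0

  OddRowSumsAre±2 : Set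
  OddRowSumsAre±2 = (i : ℕ) → 1 < i → i ≤ 4 ℕ.* t ℕ.+ 2 → ¬ (2 ∣ i) →
    (rowSum t ψ i ≡ + 2) ⊎ (rowSum t ψ i ≡ - (+ 2))

  rowBoundsAttained⇔rowSums : RowBoundsAttained ⇔ (EvenRowSumsVanish × OddRowSumsAre±2)
  rowBoundsAttained⇔rowSums = mk⇔ (λ attained → even-rows attained , odd-rows attained) from-rows
    where
    ∣rowSum∣≡rowBound : RowBoundsAttained → ∀ j → suc (suc j) ≤ 4 ℕ.* t ℕ.+ 2 →
      ∣ rowSum t ψ (suc (suc j)) ∣ ≡ rowBound (suc j)
    ∣rowSum∣≡rowBound attained j i≤4t+2 = begin
      ∣ rowSum t ψ (suc (suc j)) ∣ ≡⟨ cong ∣_∣ (rowSum≡row (suc (suc j))) ⟩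
      ∣ row (suc j) ∣              ≡⟨ cong (λ x → ∣ row (suc x) ∣) (FinP.toℕ-fromℕ< j<1+4t) ⟨
      ∣ row (suc (toℕ k)) ∣        ≡⟨ attained k ⟨
      rowBound (suc (toℕ k))       ≡⟨ cong (rowBound ∘ suc) (FinP.toℕ-fromℕ< j<1+4t) ⟩
      rowBound (suc j)             ∎
      where
      j<1+4t : j < suc (4 ℕ.* t)
      j<1+4t = 2+j≤u+2⇒j<1+u i≤4t+2
      k : Fin (suc (4 ℕ.* t))
      k = fromℕ< j<1+4t

    even-rows : RowBoundsAttained → EvenRowSumsVanish
    even-rows attained (suc zero) _ _ 2∣1 = contradiction (∣1⇒≡1 2∣1) λ ()
    even-rows attained (suc (suc j)) _ i≤4t+2 2∣i =
      ℤP.∣i∣≡0⇒i≡0 (trans (∣rowSum∣≡rowBound attained j i≤4t+2) (2∣suc⇒rowBound≡0 (suc j) 2∣i))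

    odd-rows : RowBoundsAttained → OddRowSumsAre±2
    odd-rows attained (suc zero) (s≤s ()) _ _
    odd-rows attained (suc (suc j)) _ i≤4t+2 2∤i =
      ∣x∣≡2⇒x≡±2 _ (trans (∣rowSum∣≡rowBound attained j i≤4t+2) (2∤suc⇒rowBound≡2 (suc j) 2∤i))

    from-rows : EvenRowSumsVanish × OddRowSumsAre±2 → RowBoundsAttained
    from-rows (even , odd) k = trans (bound (2 ∣? i)) (cong ∣_∣ (rowSum≡row i))
      where
      i : ℕ
      i = suc (suc (toℕ k))
      i≤4t+2 : i ≤ 4 ℕ.* t ℕ.+ 2
      i≤4t+2 = j<1+u⇒2+j≤u+2 (FinP.toℕ<n k)
      bound : Dec (2 ∣ i) → rowBound (suc (toℕ k)) ≡ ∣ rowSum t ψ i ∣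
      bound (yes 2∣i) = trans (2∣suc⇒rowBound≡0 _ 2∣i) (sym (cong ∣_∣ (even i (s≤s z≤n) i≤4t+2 2∣i)))
      bound (no 2∤i) = trans (2∤suc⇒rowBound≡2 _ 2∤i)
        (sym ([ cong ∣_∣ , cong ∣_∣ ]′ (odd i (s≤s (s≤s z≤n)) i≤4t+2 2∤i)))

lemma5 : (t : ℕ) → 1 ≤ t → (ψ : G t → G t → ℤ) →
    IsNormalizedCocycle t ψ → ¬ IsCoboundary t ψ →
    ((i : ℕ) → 2 ≤ i → i ≤ 4 ℕ.* t ℕ.+ 2 →
      (rowSum t ψ i ≡ rowSum t ψ (4 ℕ.* t ℕ.+ 4 ℕ.∸ i))
      ⊎ (rowSum t ψ i ≡ - rowSum t ψ (4 ℕ.* t ℕ.+ 4 ℕ.∸ i)))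
    × (rowSum t ψ (2 ℕ.* t ℕ.+ 2) ≡ + 0)
    × (QuasiOrthogonal t ψ ⇔
        (((i : ℕ) → 1 ≤ i → i ≤ 4 ℕ.* t ℕ.+ 2 → 2 ∣ i → rowSum t ψ i ≡ + 0)
        × ((i : ℕ) → 1 < i → i ≤ 4 ℕ.* t ℕ.+ 2 → ¬ (2 ∣ i) →
            (rowSum t ψ i ≡ + 2) ⊎ (rowSum t ψ i ≡ - (+ 2)))))
lemma5 t _ ψ (ψ-sign , ψ-normalized , ψ-cocycle) ¬coboundary =
    rowSum-mirror
  , rowSum-middle≡0 ¬coboundary
  , rowBoundsAttained⇔rowSums ⇔-∘ quasiOrthogonal⇔rowBoundsAttained
  where open Rows t ψ ψ-sign ψ-normalized ψ-cocycle
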